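{- Let $\mathcal{L}_1=(S_1,\iota_1,\rightarrow_1)$ and $\mathcal{L}_2=(S_2,\iota_2,\rightarrow_2)$ be two LTSs. Then $\mathcal{L}_1\sqsubseteq_{\mathsf{fdr}}\mathcal{L}_2$ holds if and only if no FD-witness is reachable in $\mathsf{norm}_{\mathsf{fdr}}(\mathcal{L}_1)\ltimes\mathcal{L}_2$.
   Context: Fix a finite set $\mathit{Act}$ of actions not containing the internal action $\tau$; $\mathit{Act}_\tau=\mathit{Act}\cup\{\tau\}$. An LTS is $(S,\iota,\rightarrow)$ with $\iota\in S$ and $\rightarrow\subseteq S\times\mathit{Act}_\tau\times S$; $\mathsf{enabled}(s)=\{a\in\mathit{Act}_\tau\mid\exists t: s\xrightarrow{a}t\}$. For $\sigma\in\mathit{Act}_\tau^*$, $s\overset{\sigma}{\twoheadrightarrow}t$ means there is a path from $s$ to $t$ whose labels, in order, form exactly $\sigma$; a state is reachable in an LTS if $\iota\overset{\sigma}{\twoheadrightarrow}$ it for some $\sigma\in\mathit{Act}_\tau^*$. The weak transition relation $\Longrightarrow\subseteq S\times\mathit{Act}^*\times S$ is the smallest relation with $s\overset{\epsilon}{\Longrightarrow}s$; $s\overset{\epsilon}{\Longrightarrow}t$ if $s\xrightarrow{\tau}t$; $s\overset{a}{\Longrightarrow}t$ if $s\xrightarrow{a}t$ ($a\in\mathit{Act}$); $s\overset{\rho\sigma}{\Longrightarrow}t$ if $s\overset{\rho}{\Longrightarrow}u\overset{\sigma}{\Longrightarrow}t$. A state $s$ is stable if $\tau\notin\mathsf{enabled}(s)$;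 for stable $s$, $\mathsf{refusals}(s)=\mathcal{P}(\mathit{Act}\setminus\mathsf{enabled}(s))$; for a set of states $U$, $\mathsf{refusals}(U)=\{X\subseteq\mathit{Act}\mid\exists s\in U: s\text{ stable}\wedge X\in\mathsf{refusals}(s)\}$. A state $s$ diverges if there is an infinite sequence $s\xrightarrow{\tau}s_1\xrightarrow{\tau}s_2\xrightarrow{\tau}\cdots$; a set $U$ diverges if some state of $U$ diverges. $\mathsf{divergences}(\mathcal{L})=\{\rho\sigma\in\mathit{Act}^*\mid\exists t:\iota\overset{\rho}{\Longrightarrow}t\wedge t\text{ diverges}\}$. $\mathsf{failures}(\mathcal{L})=\{(\rho,X)\in\mathit{Act}^*\times\mathcal{P}(\mathit{Act})\mid\exists t:\iota\overset{\rho}{\Longrightarrow}t,\ t\text{ stable},\ X\in\mathsf{refusals}(t)\}$ and $\mathsf{failures}_\bot(\mathcal{L})=\mathsf{failures}(\mathcal{L})\cup\{(\rho,X)\in\mathit{Act}^*\times\mathcal{P}(\mathit{Act})\mid\rho\in\mathsf{divergences}(\mathcal{L})\}$. $\mathcal{L}_1\sqsubseteq_{\mathsf{fdr}}\mathcal{L}_2$ iff $\mathsf{failures}_\bot(\mathcal{L}_2)\subseteq\mathsf{failures}_\bot(\mathcal{L}_1)$ and $\mathsf{divergences}(\mathcal{L}_2)\subseteq\mathsf{divergences}(\mathcal{L}_1)$. The failures-divergences normal form $\mathsf{norm}_{\mathsf{fdr}}(\mathcal{L})$ has states $\mathcal{P}(S)$, initial state $\{s\mid\iota\overset{\epsilon}{\Longrightarrow}s\}$,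 and for $U,V\subseteq S$, $a\in\mathit{Act}$: $U\xrightarrow{a}V$ iff $U$ does not diverge and $V=\{t\mid\exists s\in U: s\overset{a}{\Longrightarrow}t\}$ (no $\tau$-transitions). The product $\mathcal{M}\ltimes\mathcal{L}_2$ of LTSs $\mathcal{M}=(T,\iota_T,\rightarrow_T)$ and $\mathcal{L}_2$ has states $T\times S_2$, initial state $(\iota_T,\iota_2)$, and smallest transition relation with $(u,s)\xrightarrow{\tau}(u,t)$ if $s\xrightarrow{\tau}_2t$, and $(u,s)\xrightarrow{a}(u',t)$ if $u\xrightarrow{a}_Tu'$ and $s\xrightarrow{a}_2t$, for $a\in\mathit{Act}$. A state $(U,s)$ of $\mathsf{norm}_{\mathsf{fdr}}(\mathcal{L}_1)\ltimes\mathcal{L}_2$ is an FD-witness iff $U$ does not diverge and at least one holds: $U=\emptyset$; or $s$ is stable and $\mathsf{refusals}(s)\not\subseteq\mathsf{refusals}(U)$; or $s$ diverges. -}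

module Defs where

open import Level using (Level; _⊔_; Lift) renaming (suc to lsuc)
open import Data.Nat using (ℕ; zero; suc)
open import Data.Fin using (Fin)
open import Data.Fin.Subset using (Subset; _∈_)
open import Data.List using (List; []; _∷_; _++_)
open import Data.Product using (Σ; ∃; _×_; _,_)
open import Data.Sum using (_⊎_)
open import Data.Empty using (⊥)
open import Relation.Nullary using (¬_)
open import Relation.Binary.PropositionalEquality using (_≡_)
open import Function.Bundles using (_⇔_)

data Actτ (n : ℕ) : Set where
  τ   : Actτ n
  act : Fin n → Actτ n

record LTS (n : ℕ) (ℓ : Level) : Set (lsuc ℓ) where
  field
    State : Set ℓ
    init  : State
    _⟶[_]_ : State → Actτ n → State → Set ℓ

module _ {n : ℕ} {ℓ : Level} (L : LTS n ℓ) where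
  open LTS L

  Enabled : State → Actτ n → Set ℓ
  Enabled s a = ∃ λ t → s ⟶[ a ] t

  Stable : State → Set ℓ
  Stable s = ¬ Enabled s τ

  -- X ∈ refusals(s)  (for stable s):  X ⊆ Act ∖ enabled(s)
  Refuses : State → Subset n → Set ℓ
  Refuses s X = ∀ a → a ∈ X → ¬ Enabled s (act a)

  RefusalsOf : (State → Set ℓ) → Subset n → Set ℓ
  RefusalsOf U X = ∃ λ s → U s × Stable s × Refuses s X

  data Path : State → List (Actτ n) → State → Set ℓ where
    nil  : ∀ {s} → Path s [] s
    cons : ∀ {s u t a σ} → s ⟶[ a ] u → Path u σ t → Path s (a ∷ σ) t

  Reachable : State → Set ℓ
  Reachable s = ∃ λ σ → Path init σ s

  data Weak : State → List (Fin n) → State → Set ℓ where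
    w-refl  : ∀ {s} → Weak s [] s
    w-tau   : ∀ {s t} → s ⟶[ τ ] t → Weak s [] t
    w-act   : ∀ {s t} a → s ⟶[ act a ] t → Weak s (a ∷ []) t
    w-trans : ∀ {s u t ρ σ} → Weak s ρ u → Weak u σ t → Weak s (ρ ++ σ) t

  Diverges : State → Set ℓ
  Diverges s = Σ (ℕ → State) λ f → f zero ≡ s × (∀ i → f i ⟶[ τ ] f (suc i))

  DivergesSet : (State → Set ℓ) → Set ℓ
  DivergesSet U = ∃ λ s → U s × Diverges s

  EmptySet : (State → Set ℓ) → Set ℓ
  EmptySet U = ∀ s → ¬ U s

  divergences : List (Fin n) → Set ℓ
  divergences w = ∃ λ ρ → ∃ λ σ → w ≡ ρ ++ σ × ∃ λ t → Weak init ρ t × Diverges t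

  failures : List (Fin n) → Subset n → Set ℓ
  failures ρ X = ∃ λ t → Weak init ρ t × Stable t × Refuses t X

  failures⊥ : List (Fin n) → Subset n → Set ℓ
  failures⊥ ρ X = failures ρ X ⊎ divergences ρ

_⊑fdr_ : ∀ {n ℓ₁ ℓ₂} → LTS n ℓ₁ → LTS n ℓ₂ → Set (ℓ₁ ⊔ ℓ₂)
L₁ ⊑fdr L₂ = (∀ ρ X → failures⊥ L₂ ρ X → failures⊥ L₁ ρ X)
           × (∀ w → divergences L₂ w → divergences L₁ w)

-- failures-divergences normal form: states are subsets (predicates) of S;
-- "V = {t | ∃ s ∈ U. s ==a==> t}" is read as extensional equality of predicates.
normFdr : ∀ {n ℓ} → LTS n ℓ → LTS n (lsuc ℓ)
normFdr {n} {ℓ} L = record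
  { State = LTS.State L → Set ℓ
  ; init  = λ s → Weak L (LTS.init L) [] s
  ; _⟶[_]_ = step
  }
  where
  step : (LTS.State L → Set ℓ) → Actτ n → (LTS.State L → Set ℓ) → Set (lsuc ℓ)
  step U τ V = Lift (lsuc ℓ) ⊥
  step U (act a) V = Lift (lsuc ℓ)
    (¬ DivergesSet L U × (∀ t → V t ⇔ (∃ λ s → U s × Weak L s (a ∷ []) t)))

_⋉_ : ∀ {n a b} → LTS n a → LTS n b → LTS n (a ⊔ b)
_⋉_ {n} {a} {b} M L₂ = record
  { State = LTS.State M × LTS.State L₂
  ; init  = LTS.init M , LTS.init L₂
  ; _⟶[_]_ = step
  }
  where
  open LTS M renaming (_⟶[_]_ to _⟶M[_]_)
  open LTS L₂ renaming (_⟶[_]_ to _⟶₂[_]_)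
  step : LTS.State M × LTS.State L₂ → Actτ n → LTS.State M × LTS.State L₂ → Set (a ⊔ b)
  step (u , s) τ (u' , t) = Lift (a ⊔ b) (u ≡ u') × s ⟶₂[ τ ] t
  step (u , s) (act x) (u' , t) = u ⟶M[ act x ] u' × s ⟶₂[ act x ] t

FDWitness : ∀ {n ℓ₁ ℓ₂} (L₁ : LTS n ℓ₁) (L₂ : LTS n ℓ₂)
          → LTS.State (normFdr L₁ ⋉ L₂) → Set (ℓ₁ ⊔ ℓ₂)
FDWitness L₁ L₂ (U , s) =
  ¬ DivergesSet L₁ U
  × (EmptySet L₁ U
     ⊎ (Stable L₂ s × ¬ (∀ X → Refuses L₂ s X → RefusalsOf L₁ U X))
     ⊎ Diverges L₂ s)

module Submission where

-- The proof rests on one invariant of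
-- the product: its reachable states (U , s) are, up to inclusion
-- After ρ ⊆ U, exactly the pairs where s is reached in L₂ by a weak trace ρ
-- and After ρ = {t | ι₁ ==ρ==> t} is the normal-form state after ρ, as long
-- as L₁ does not diverge on ρ.
--
-- Each kind of
-- FD-witness then translates into a failure or divergence of L₂ that L₁
-- lacks, which gives the two directions of the theorem.

open import Defs
open import Level using (Level; _⊔_; lift; lower) renaming (suc to lsuc)
open import Data.Nat using (ℕ; zero; suc)
open import Data.Fin using (Fin)
open import Data.Fin.Subset using () renaming (⊥ to ∅)
open import Data.Fin.Subset.Properties using (∉⊥)
open import Data.List using (List; []; _∷_; _++_)
open import Data.List.Properties using (∷-injective; ++-identityʳ; ++-assoc; ++-conicalˡ)
open import Data.Product using (Σ; ∃; _×_; _,_; proj₁; proj₂)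
open import Data.Sum using (_⊎_; inj₁; inj₂)
open import Data.Empty using (⊥-elim) renaming (⊥ to Empty)
open import Relation.Nullary using (¬_; yes; no)
open import Relation.Nullary.Decidable using (map′; decidable-stable)
open import Relation.Unary using (_⊆_)
open import Relation.Binary.PropositionalEquality using (_≡_; refl; sym; cong; subst)
open import Function.Bundles using (_⇔_; mk⇔; Equivalence)
open import Axiom.ExcludedMiddle using (ExcludedMiddle)

lower-EM : ∀ {a} b → ExcludedMiddle (a ⊔ b) → ExcludedMiddle a
lower-EM b em = map′ lower (lift {ℓ = b}) em

visible : ∀ {n} → List (Actτ n) → List (Fin n)
visible [] = []
visible (τ ∷ σ) = visible σ
visible (act a ∷ σ) = a ∷ visible σ

visible-++ : ∀ {n} (σ σ' : List (Actτ n)) → visible (σ ++ σ') ≡ visible σ ++ visible σ'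
visible-++ [] σ' = refl
visible-++ (τ ∷ σ) σ' = visible-++ σ σ'
visible-++ (act a ∷ σ) σ' = cong (a ∷_) (visible-++ σ σ')

prefix-of-snoc : ∀ {a} {A : Set a} (α β ρ : List A) x → α ++ β ≡ ρ ++ x ∷ []
               → (α ≡ ρ ++ x ∷ []) ⊎ (∃ λ β' → α ++ β' ≡ ρ)
prefix-of-snoc [] β ρ x eq = inj₂ (ρ , refl)
prefix-of-snoc (a ∷ α) β [] x eq with ∷-injective eq
... | refl , α++β≡[] = inj₁ (cong (a ∷_) (++-conicalˡ α β α++β≡[]))
prefix-of-snoc (a ∷ α) β (r ∷ ρ) x eq with ∷-injective eq
... | refl , eq' with prefix-of-snoc α β ρ x eq'
... | inj₁ e = inj₁ (cong (a ∷_) e)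
... | inj₂ (β' , e) = inj₂ (β' , cong (a ∷_) e)

module Traces {n : ℕ} {ℓ : Level} (L : LTS n ℓ) where
  open LTS L

  path-++ : ∀ {s u t σ σ'} → Path L s σ u → Path L u σ' t → Path L s (σ ++ σ') t
  path-++ nil q = q
  path-++ (cons e p) q = cons e (path-++ p q)

  path⇒weak : ∀ {s σ t} → Path L s σ t → Weak L s (visible σ) t
  path⇒weak nil = w-refl
  path⇒weak (cons {a = τ} e p) = w-trans (w-tau e) (path⇒weak p)
  path⇒weak (cons {a = act a} e p) = w-trans (w-act a e) (path⇒weak p)

  weak⇒path : ∀ {s ρ t} → Weak L s ρ t → ∃ λ σ → Path L s σ t × visible σ ≡ ρ
  weak⇒path w-refl = [] , nil , refl
  weak⇒path (w-tau e) = τ ∷ [] , cons e nil , refl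
  weak⇒path (w-act a e) = act a ∷ [] , cons e nil , refl
  weak⇒path (w-trans w v) with weak⇒path w | weak⇒path v
  ... | σ , p , refl | σ' , p' , refl = σ ++ σ' , path-++ p p' , visible-++ σ σ'

  path-split : ∀ ρ {ρ' s σ t} → Path L s σ t → visible σ ≡ ρ ++ ρ'
             → ∃ λ u → Weak L s ρ u × Weak L u ρ' t
  path-split [] {s = s} p refl = s , w-refl , path⇒weak p
  path-split (a ∷ ρ) nil ()
  path-split (a ∷ ρ) (cons {a = τ} e p) eq with path-split (a ∷ ρ) p eq
  ... | u , w₁ , w₂ = u , w-trans (w-tau e) w₁ , w₂
  path-split (a ∷ ρ) (cons {a = act b} e p) eq with ∷-injective eq
  ... | refl , eq' with path-split ρ p eq'
  ... | u , w₁ , w₂ = u , w-trans (w-act b e) w₁ , w₂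

  weak-split : ∀ ρ {ρ' s t} → Weak L s (ρ ++ ρ') t → ∃ λ u → Weak L s ρ u × Weak L u ρ' t
  weak-split ρ w with weak⇒path w
  ... | σ , p , eq = path-split ρ p eq

  weak-silent : ∀ {s u t ρ} → Weak L s ρ u → Weak L u [] t → Weak L s ρ t
  weak-silent {ρ = ρ} w v = subst (λ r → Weak L _ r _) (++-identityʳ ρ) (w-trans w v)

  diverges-mono : ∀ {U V : State → Set ℓ} → U ⊆ V → DivergesSet L U → DivergesSet L V
  diverges-mono U⊆V (t , t∈U , d) = t , U⊆V t∈U , d

  -- Classically, a state either τ-reaches a stable state or diverges:
  -- if no stable state is τ-reachable, τ-steps can be chosen forever.
  stabilise-or-diverge : ExcludedMiddle ℓ → ∀ s
                       → (∃ λ t → Weak L s [] t × Stable L t) ⊎ Diverges L s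
  stabilise-or-diverge em s with em {∃ λ t → Weak L s [] t × Stable L t}
  ... | yes stabilises = inj₁ stabilises
  ... | no ¬stabilises = inj₂ (trajectory , refl , λ i → proj₂ (next (run i)))
    where
    next : (x : Σ State (Weak L s [])) → Enabled L (proj₁ x) τ
    next (t , w) = decidable-stable em (λ ¬τ → ¬stabilises (t , w , ¬τ))
    run : ℕ → Σ State (Weak L s [])
    run zero = s , w-refl
    run (suc i) = proj₁ (next (run i)) , w-trans (proj₂ (run i)) (w-tau (proj₂ (next (run i))))
    trajectory : ℕ → State
    trajectory i = proj₁ (run i)

module NormalForm {n : ℕ} {ℓ : Level} (L : LTS n ℓ) where
  open Traces L
  open LTS (normFdr L) using () renaming (_⟶[_]_ to _⟶N[_]_)

  After : List (Fin n) → LTS.State L → Set ℓ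
  After ρ = Weak L (LTS.init L) ρ

  after-divergence : ∀ {ρ} → DivergesSet L (After ρ) → divergences L ρ
  after-divergence {ρ} (t , w , d) = ρ , [] , sym (++-identityʳ ρ) , t , w , d

  divergences-extend : ∀ {ρ} σ → divergences L ρ → divergences L (ρ ++ σ)
  divergences-extend σ (α , β , refl , t , w , d) = α , β ++ σ , ++-assoc α β σ , t , w , d

  divergences-[] : divergences L [] → DivergesSet L (After [])
  divergences-[] (α , β , eq , t , w , d) =
    t , subst (λ r → After r t) (++-conicalˡ α β (sym eq)) w , d

  divergences-snoc : ∀ ρ x → divergences L (ρ ++ x ∷ [])
                   → divergences L ρ ⊎ DivergesSet L (After (ρ ++ x ∷ []))
  divergences-snoc ρ x (α , β , eq , t , w , d) with prefix-of-snoc α β ρ x (sym eq)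
  ... | inj₁ refl = inj₂ (t , w , d)
  ... | inj₂ (β' , e) = inj₁ (α , β' , sym e , t , w , d)

  normal-step : ∀ ρ a → ¬ DivergesSet L (After ρ) → After ρ ⟶N[ act a ] After (ρ ++ a ∷ [])
  normal-step ρ a nd =
    lift (nd , λ t → mk⇔ (weak-split ρ) (λ (s , w , v) → w-trans w v))

  normal-step-⊇ : ∀ {ρ a U V} → After ρ ⊆ U → U ⟶N[ act a ] V → After (ρ ++ a ∷ []) ⊆ V
  normal-step-⊇ {ρ} After⊆U (lift (_ , V⇔)) {t} w with weak-split ρ w
  ... | u , w₁ , w₂ = Equivalence.from (V⇔ t) (u , After⊆U w₁ , w₂)

module Product {n : ℕ} {ℓ₁ ℓ₂ : Level} (L₁ : LTS n ℓ₁) (L₂ : LTS n ℓ₂) where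
  open Traces
  open NormalForm L₁

  P : LTS n (lsuc ℓ₁ ⊔ ℓ₂)
  P = normFdr L₁ ⋉ L₂

  simulate : ∀ ρ {s σ t} → Path L₂ s σ t → ¬ divergences L₁ (ρ ++ visible σ)
           → Path P (After ρ , s) σ (After (ρ ++ visible σ) , t)
  simulate ρ {s} nil nd = subst (λ r → Path P (After ρ , s) [] (After r , s)) (sym (++-identityʳ ρ)) nil
  simulate ρ (cons {a = τ} e p) nd = cons (lift refl , e) (simulate ρ p nd)
  simulate ρ (cons {t = t} {a = act a} {σ = σ} e p) nd =
    cons (normal-step ρ a (λ dv → nd (divergences-extend (a ∷ visible σ) (after-divergence dv))) , e)
         (subst (λ r → Path P _ σ (After r , t)) ρa-assoc
                (simulate (ρ ++ a ∷ []) p (subst (λ r → ¬ divergences L₁ r) (sym ρa-assoc) nd)))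
    where
    ρa-assoc : (ρ ++ a ∷ []) ++ visible σ ≡ ρ ++ a ∷ visible σ
    ρa-assoc = ++-assoc ρ (a ∷ []) (visible σ)

  trace-reachable : ∀ {ρ t} → ¬ divergences L₁ ρ → Weak L₂ (LTS.init L₂) ρ t
                  → Reachable P (After ρ , t)
  trace-reachable nd w with weak⇒path L₂ w
  ... | σ , p , refl = σ , simulate [] p nd

  Invariant : LTS.State P → List (Fin n) → Set (ℓ₁ ⊔ ℓ₂)
  Invariant (U , s) ρ = After ρ ⊆ U × Weak L₂ (LTS.init L₂) ρ s
                      × (¬ DivergesSet L₁ U → ¬ divergences L₁ ρ)

  invariant-path : ∀ {p q σ ρ} → Path P p σ q → Invariant p ρ → ∃ (Invariant q)
  invariant-path nil inv = _ , inv
  invariant-path (cons {a = τ} (lift refl , e) p) (⊆U , w , nd) =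
    invariant-path p (⊆U , weak-silent L₂ w (w-tau e) , nd)
  invariant-path {ρ = ρ} (cons {u = V , _} {a = act x} (step@(lift (ndU , _)) , e) p) (⊆U , w , nd) =
    invariant-path p (⊆V , w-trans w (w-act x e) , nondivergent)
    where
    ⊆V : After (ρ ++ x ∷ []) ⊆ V
    ⊆V = normal-step-⊇ ⊆U step
    nondivergent : ¬ DivergesSet L₁ V → ¬ divergences L₁ (ρ ++ x ∷ [])
    nondivergent ndV dv with divergences-snoc ρ x dv
    ... | inj₁ dvρ = nd ndU dvρ
    ... | inj₂ dvAfter = ndV (diverges-mono L₁ ⊆V dvAfter)

  reachable-trace : ∀ {q} → Reachable P q → ∃ (Invariant q)
  reachable-trace (σ , p) =
    invariant-path p ((λ w → w) , w-refl , λ ndU dv → ndU (divergences-[] dv))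

  FDWitnessKind : LTS.State P → Set (ℓ₁ ⊔ ℓ₂)
  FDWitnessKind (U , s) = EmptySet L₁ U
                        ⊎ (Stable L₂ s × ¬ (∀ X → Refuses L₂ s X → RefusalsOf L₁ U X))
                        ⊎ Diverges L₂ s

  -- Refinement rules out witnesses: after the trace ρ leading to a witness,
  -- L₂ has a failure or divergence that the non-divergent U cannot match.
  refinement⇒no-witness : ExcludedMiddle ℓ₂ → L₁ ⊑fdr L₂
                        → ¬ (∃ λ p → Reachable P p × FDWitness L₁ L₂ p)
  refinement⇒no-witness em (failures⊑ , divergences⊑) ((U , s) , reach , ndU , kind)
    with reachable-trace reach
  ... | ρ , ⊆U , w , nd⇒ = impossible kind
    where
    no-divergence : ¬ Diverges L₂ s
    no-divergence d = nd⇒ ndU (divergences⊑ ρ (NormalForm.after-divergence L₂ (s , w , d)))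

    refusal : ∀ X → failures L₂ ρ X → RefusalsOf L₁ U X
    refusal X f with failures⊑ ρ X (inj₁ f)
    ... | inj₁ (t , wt , st , r) = t , ⊆U wt , st , r
    ... | inj₂ dv = ⊥-elim (nd⇒ ndU dv)

    impossible : FDWitnessKind (U , s) → Empty
    impossible (inj₁ empty) with stabilise-or-diverge L₂ em s
    ... | inj₂ d = no-divergence d
    ... | inj₁ (t , wt , st) with refusal ∅ (t , weak-silent L₂ w wt , st , λ a a∈∅ → ⊥-elim (∉⊥ a∈∅))
    ...   | u , u∈U , _ = empty u u∈U
    impossible (inj₂ (inj₁ (st , ¬refusals))) = ¬refusals (λ X r → refusal X (s , w , st , r))
    impossible (inj₂ (inj₂ d)) = no-divergence d

  -- Absence of witnesses gives refinement: a failure or divergence of L₂ on ρ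
  -- missing from L₁ yields the reachable witness (After ρ , t).
  no-witness⇒refinement : ExcludedMiddle ℓ₁
                        → ¬ (∃ λ p → Reachable P p × FDWitness L₁ L₂ p) → L₁ ⊑fdr L₂
  no-witness⇒refinement em no-witness = failures⊑ , divergences⊑
    where
    witness : ∀ {ρ t} → ¬ divergences L₁ ρ → Weak L₂ (LTS.init L₂) ρ t
            → FDWitnessKind (After ρ , t) → Empty
    witness nd w kind =
      no-witness ((After _ , _) , trace-reachable nd w , (λ dv → nd (after-divergence dv)) , kind)

    divergences⊑ : ∀ w → divergences L₂ w → divergences L₁ w
    divergences⊑ _ (ρ , σ , refl , t , wt , d) with em {divergences L₁ ρ}
    ... | yes dv = divergences-extend σ dv
    ... | no nd = ⊥-elim (witness nd wt (inj₂ (inj₂ d)))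

    failures⊑ : ∀ ρ X → failures⊥ L₂ ρ X → failures⊥ L₁ ρ X
    failures⊑ ρ X (inj₂ dv) = inj₂ (divergences⊑ ρ dv)
    failures⊑ ρ X (inj₁ (t , wt , st , r)) with em {divergences L₁ ρ}
    ... | yes dv = inj₂ dv
    ... | no nd with em {failures L₁ ρ X}
    ...   | yes f = inj₁ f
    ...   | no ¬f = ⊥-elim (witness nd wt (inj₂ (inj₁ (st , λ refusals → ¬f (refusals X r)))))

theorem3p24 : ∀ {ℓ₁ ℓ₂ : Level} → ExcludedMiddle (lsuc (ℓ₁ ⊔ ℓ₂))
    → (n : ℕ) (L₁ : LTS n ℓ₁) (L₂ : LTS n ℓ₂)
    → (L₁ ⊑fdr L₂)
      ⇔ (¬ (∃ λ p → Reachable (normFdr L₁ ⋉ L₂) p × FDWitness L₁ L₂ p))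
theorem3p24 {ℓ₁} {ℓ₂} em n L₁ L₂ =
  mk⇔ (refinement⇒no-witness (lower-EM (lsuc (ℓ₁ ⊔ ℓ₂)) em))
      (no-witness⇒refinement (lower-EM (lsuc (ℓ₁ ⊔ ℓ₂)) em))
  where open Product L₁ L₂
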